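{- Let $G$ be a finite simple graph with an edge-coloring $C:E(G)\to\mathbb{N}^{+}$. Then $G$ contains a spanning bipartite subgraph $H$ such that $$2d_{H}^{c}(v)+3d_{H}(v)\geq d_G^{c}(v)+d_G(v)$$ for every vertex $v\in V(H)$.
   Context: An edge-coloring is an arbitrary function from the edge set to the positive integers. For a subgraph $F$ of $G$ containing the vertex $v$, $d_F(v)$ is the degree of $v$ in $F$ and $d^{c}_F(v)$, the color degree of $v$ in $F$, is the number of distinct colors among the edges of $F$ incident to $v$. A spanning bipartite subgraph of $G$ is a subgraph with vertex set $V(G)$ that is bipartite. -}

module Defs where

open import Data.Nat using (ℕ; _≟_; _<_)
open import Data.Bool using (Bool; true; false; T; _≤_)
open import Data.Fin using (Fin)
open import Data.List using (List; length; map; filterᵇ; allFin; deduplicate)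
open import Relation.Binary.PropositionalEquality using (_≡_)
open import Relation.Nullary using (¬_)
open import Data.Product using (Σ)

record SimpleGraph (n : ℕ) : Set where
  field
    adj     : Fin n → Fin n → Bool
    symm    : ∀ u v → adj u v ≡ adj v u
    irrefl  : ∀ v → adj v v ≡ false
open SimpleGraph public

-- An edge-coloring C : E(G) → ℕ⁺, represented as a symmetric function on
-- ordered pairs whose values on edges are positive (values on non-edges are
-- irrelevant).
record EdgeColoring {n : ℕ} (G : SimpleGraph n) : Set where
  field
    col      : Fin n → Fin n → ℕ
    colSymm  : ∀ u v → T (adj G u v) → col u v ≡ col v u
    colPos   : ∀ u v → T (adj G u v) → 0 < col u v
open EdgeColoring public

nbrs : {n : ℕ} → (Fin n → Fin n → Bool) → Fin n → List (Fin n)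
nbrs {n} F v = filterᵇ (F v) (allFin n)

deg : {n : ℕ} → (Fin n → Fin n → Bool) → Fin n → ℕ
deg F v = length (nbrs F v)

cdeg : {n : ℕ} → (Fin n → Fin n → ℕ) → (Fin n → Fin n → Bool) → Fin n → ℕ
cdeg c F v = length (deduplicate _≟_ (map (c v) (nbrs F v)))

record SpanningSubgraph {n : ℕ} (G : SimpleGraph n) (F : Fin n → Fin n → Bool) : Set where
  field
    sub-symm   : ∀ u v → F u v ≡ F v u
    sub-irrefl : ∀ v → F v v ≡ false
    sub-edges  : ∀ u v → T (F u v) → T (adj G u v)
open SpanningSubgraph public

IsBipartite : {n : ℕ} → (Fin n → Fin n → Bool) → Set
IsBipartite {n} F = Σ (Fin n → Bool) λ side →
  ∀ u v → T (F u v) → ¬ (side u ≡ side v)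

-- Split the vertices into two sides and let H be the graph of edges crossing
-- the cut. Choose a split that is locally maximal for the potential
-- Φ = Σᵤ (d_H(u) + 2 d^c_H(u)) under moving one vertex v to the other side.
-- The move exchanges the cut and uncut edges at v; a neighbour u of v loses
-- at most 3 from its summand if uv was cut and gains at least 1 if it was not,
-- while the summand of v becomes d_K(v) + 2 d^c_K(v) for the uncut edges K.
-- Local maximality thus gives d_K(v) + d^c_K(v) ≤ 2 d_H(v) + d^c_H(v), and
-- d_G = d_H + d_K, d^c_G ≤ d^c_H + d^c_K finish the bound.
module Submission where

open import Defs
import Algebra.Properties.Semiring.Sum as SemiringSum
open import Data.Bool using (Bool; true; false; T; T?; not; _∧_; _xor_)
open import Data.Bool.Properties using (xor-comm; xor-same; not-distribˡ-xor; T-∧)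
open import Data.Empty using (⊥-elim)
open import Data.Fin using (Fin; zero; suc; punchIn)
open import Data.Fin.Properties using (any?; punchInᵢ≢i) renaming (_≟_ to _≟ᶠ_)
open import Data.List
  using (List; []; _∷_; length; map; filter; filterᵇ; allFin; tabulate; deduplicate; _++_)
open import Data.List.Membership.Propositional using (_∈_)
open import Data.List.Membership.Propositional.Properties
  using (∈-map⁺; ∈-map⁻; ∈-filter⁺; ∈-filter⁻; ∈-allFin; ∈-deduplicate⁺; ∈-deduplicate⁻;
         ∈-++⁺ˡ; ∈-++⁺ʳ)
open import Data.List.Properties
  using (length-map; length-++; length-deduplicate; length-filter; length-tabulate; filter-notAll)
open import Data.List.Relation.Binary.Subset.Propositional using (_⊆_)
import Data.List.Relation.Unary.All as All
import Data.List.Relation.Unary.Any as Any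
open import Data.List.Relation.Unary.AllPairs using (_∷_)
open import Data.List.Relation.Unary.Unique.Propositional using (Unique)
open import Data.List.Relation.Unary.Unique.DecPropositional.Properties using (deduplicate-!)
open import Data.Nat using (ℕ; zero; suc; _+_; _*_; _≤_; _≥_; _<?_; _≟_; z≤n)
open import Data.Nat.Properties
open import Data.Nat.Tactic.RingSolver using (solve-∀)
open import Data.Product using (Σ; _×_; _,_; proj₁; proj₂)
open import Data.Sum using (_⊎_; inj₁; inj₂; map₂)
open import Data.Vec.Functional using (updateAt)
open import Data.Vec.Functional.Properties using (updateAt-updates; updateAt-minimal)
open import Function using (_∘_; id)
open import Function.Bundles using (Equivalence)
open import Relation.Binary.Definitions using (DecidableEquality)
open import Relation.Nullary using (yes; no; ¬?)
open import Relation.Binary.PropositionalEquality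

open SemiringSum +-*-semiring using (sum; sum-cong-≗; ∑-distrib-+; *-distribˡ-sum; sum-remove)

sum-mono-≤ : ∀ {n} {f g : Fin n → ℕ} → (∀ i → f i ≤ g i) → sum f ≤ sum g
sum-mono-≤ {zero}  f≤g = z≤n
sum-mono-≤ {suc n} f≤g = +-mono-≤ (f≤g zero) (sum-mono-≤ (f≤g ∘ suc))

sum-≤-except : ∀ {n} (f g : Fin n → ℕ) (v : Fin n) →
               (∀ u → u ≢ v → f u ≤ g u) → sum f + g v ≤ sum g + f v
sum-≤-except {suc n} f g v f≤g = begin
  sum f + g v                     ≡⟨ cong (_+ g v) (sum-remove {i = v} f) ⟩
  f v + sum (f ∘ punchIn v) + g v ≤⟨ +-monoˡ-≤ (g v) (+-monoʳ-≤ (f v) rest) ⟩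
  f v + sum (g ∘ punchIn v) + g v ≡⟨ swap (f v) (sum (g ∘ punchIn v)) (g v) ⟩
  g v + sum (g ∘ punchIn v) + f v ≡⟨ cong (_+ f v) (sum-remove {i = v} g) ⟨
  sum g + f v                     ∎
  where
  open ≤-Reasoning
  rest : sum (f ∘ punchIn v) ≤ sum (g ∘ punchIn v)
  rest = sum-mono-≤ (λ i → f≤g (punchIn v i) (punchInᵢ≢i v i))
  swap : ∀ a b c → a + b + c ≡ c + b + a
  swap = solve-∀

module _ {X : Set} {m : ℕ} (φ : X → ℕ) (move : X → Fin m → X) where

  LocallyMaximal : X → Set
  LocallyMaximal x = ∀ i → φ (move x i) ≤ φ x

  locallyMaximal-exists : (B : ℕ) → (∀ x → φ x ≤ B) → X → Σ X LocallyMaximal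
  locallyMaximal-exists B φ≤B x₀ = climb B x₀ (m≤n+m B (φ x₀))
    where
    climb : ∀ fuel x → B ≤ φ x + fuel → Σ X LocallyMaximal
    climb zero x B≤φx =
      x , λ i → ≤-trans (φ≤B (move x i)) (subst (B ≤_) (+-identityʳ (φ x)) B≤φx)
    climb (suc fuel) x B≤ with any? (λ i → φ x <? φ (move x i))
    ... | yes (i , φx<φx') = climb fuel (move x i)
          (≤-trans B≤ (≤-trans (≤-reflexive (+-suc (φ x) fuel)) (+-monoˡ-≤ fuel φx<φx')))
    ... | no ¬improvable = x , λ i → ≮⇒≥ (λ φx<φx' → ¬improvable (i , φx<φx'))

module _ {A : Set} (_≟ᴬ_ : DecidableEquality A) where

  Unique-⊆⇒length≤ : ∀ {xs ys : List A} → Unique xs → xs ⊆ ys → length xs ≤ length ys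
  Unique-⊆⇒length≤ {[]}     _            _       = z≤n
  Unique-⊆⇒length≤ {x ∷ xs} {ys} (x≢xs ∷ !xs) x∷xs⊆ys = begin-strict
    length xs              ≤⟨ Unique-⊆⇒length≤ !xs xs⊆ys-x ⟩
    length (filter ≢x? ys) <⟨ filter-notAll ≢x? ys (Any.map (λ { refl ≢x → ≢x refl }) x∈ys) ⟩
    length ys              ∎
    where
    open ≤-Reasoning
    ≢x? = λ y → ¬? (y ≟ᴬ x)
    x∈ys : x ∈ ys
    x∈ys = x∷xs⊆ys (Any.here refl)
    xs⊆ys-x : xs ⊆ filter ≢x? ys
    xs⊆ys-x z∈xs = ∈-filter⁺ ≢x? (x∷xs⊆ys (Any.there z∈xs)) λ { refl → All.lookup x≢xs z∈xs refl }

𝟙 : Bool → ℕ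
𝟙 true  = 1
𝟙 false = 0

module _ {n : ℕ} where

  length-filterᵇ-tabulate : ∀ {k} (p : Fin n → Bool) (f : Fin k → Fin n) →
                            length (filterᵇ p (tabulate f)) ≡ sum (𝟙 ∘ p ∘ f)
  length-filterᵇ-tabulate {zero}  p f = refl
  length-filterᵇ-tabulate {suc k} p f with p (f zero)
  ... | true  = cong suc (length-filterᵇ-tabulate p (f ∘ suc))
  ... | false = length-filterᵇ-tabulate p (f ∘ suc)

  deg≡∑ : (F : Fin n → Fin n → Bool) (u : Fin n) → deg F u ≡ sum (𝟙 ∘ F u)
  deg≡∑ F u = length-filterᵇ-tabulate (F u) id

  deg≤n : (F : Fin n → Fin n → Bool) (u : Fin n) → deg F u ≤ n
  deg≤n F u = subst (deg F u ≤_) (length-tabulate {n = n} id) (length-filter (T? ∘ F u) (allFin n))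

  deg≡∑-column : (F : Fin n → Fin n → Bool) → (∀ u w → F u w ≡ F w u) →
                 ∀ v → deg F v ≡ sum (λ u → 𝟙 (F u v))
  deg≡∑-column F F-symm v = trans (deg≡∑ F v) (sum-cong-≗ (λ u → cong 𝟙 (F-symm v u)))

  deg-≤-except : (F F′ : Fin n → Fin n → Bool) (u v : Fin n) →
                 (∀ w → w ≢ v → F u w ≡ F′ u w) → deg F u + 𝟙 (F′ u v) ≤ deg F′ u + 𝟙 (F u v)
  deg-≤-except F F′ u v agree =
    subst₂ _≤_ (cong (_+ 𝟙 (F′ u v)) (sym (deg≡∑ F u))) (cong (_+ 𝟙 (F u v)) (sym (deg≡∑ F′ u)))
      (sum-≤-except (𝟙 ∘ F u) (𝟙 ∘ F′ u) v (λ w w≢v → ≤-reflexive (cong 𝟙 (agree w w≢v))))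

  module _ (c : Fin n → Fin n → ℕ) where

    colours : (Fin n → Fin n → Bool) → Fin n → List ℕ
    colours F u = deduplicate _≟_ (map (c u) (nbrs F u))

    ∈-colours : ∀ F {u w} → T (F u w) → c u w ∈ colours F u
    ∈-colours F {u} {w} uw∈F =
      ∈-deduplicate⁺ _≟_ (∈-map⁺ (c u) (∈-filter⁺ (T? ∘ F u) (∈-allFin w) uw∈F))

    cdeg≤deg : (F : Fin n → Fin n → Bool) (u : Fin n) → cdeg c F u ≤ deg F u
    cdeg≤deg F u = ≤-trans (length-deduplicate _≟_ (map (c u) (nbrs F u)))
                           (≤-reflexive (length-map (c u) (nbrs F u)))

    cdeg≤length : (F : Fin n → Fin n → Bool) (u : Fin n) (ys : List ℕ) →
                  (∀ w → T (F u w) → c u w ∈ ys) → cdeg c F u ≤ length ys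
    cdeg≤length F u ys colours⊆ys =
      Unique-⊆⇒length≤ _≟_ (deduplicate-! _≟_ (map (c u) (nbrs F u))) ⊆ys
      where
      ⊆ys : colours F u ⊆ ys
      ⊆ys z∈ with ∈-map⁻ (c u) (∈-deduplicate⁻ _≟_ (map (c u) (nbrs F u)) z∈)
      ... | w , w∈nbrs , refl = colours⊆ys w (proj₂ (∈-filter⁻ (T? ∘ F u) {xs = allFin n} w∈nbrs))

    cdeg-≤-except : (F F′ : Fin n → Fin n → Bool) (u v : Fin n) →
                    (∀ w → w ≢ v → T (F u w) → T (F′ u w)) → cdeg c F u ≤ cdeg c F′ u + 𝟙 (F u v)
    cdeg-≤-except F F′ u v F⊆F′ with F u v in uv∈F
    ... | false = subst (cdeg c F u ≤_) (sym (+-identityʳ _)) (cdeg≤length F u _ covered)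
      where
      covered : ∀ w → T (F u w) → c u w ∈ colours F′ u
      covered w uw∈F with w ≟ᶠ v
      ... | yes refl = ⊥-elim (subst T uv∈F uw∈F)
      ... | no w≢v   = ∈-colours F′ (F⊆F′ w w≢v uw∈F)
    ... | true  =
      subst (cdeg c F u ≤_) (+-comm 1 _) (cdeg≤length F u (c u v ∷ colours F′ u) covered)
      where
      covered : ∀ w → T (F u w) → c u w ∈ c u v ∷ colours F′ u
      covered w uw∈F with w ≟ᶠ v
      ... | yes refl = Any.here refl
      ... | no w≢v   = Any.there (∈-colours F′ (F⊆F′ w w≢v uw∈F))

    cdeg-≤-+ : (A F F′ : Fin n → Fin n → Bool) (u : Fin n) →
               (∀ w → T (A u w) → T (F u w) ⊎ T (F′ u w)) → cdeg c A u ≤ cdeg c F u + cdeg c F′ u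
    cdeg-≤-+ A F F′ u A⊆F∪F′ = subst (cdeg c A u ≤_) (length-++ (colours F u))
      (cdeg≤length A u (colours F u ++ colours F′ u) covered)
      where
      covered : ∀ w → T (A u w) → c u w ∈ colours F u ++ colours F′ u
      covered w uw∈A with A⊆F∪F′ w uw∈A
      ... | inj₁ uw∈F  = ∈-++⁺ˡ (∈-colours F uw∈F)
      ... | inj₂ uw∈F′ = ∈-++⁺ʳ (colours F u) (∈-colours F′ uw∈F′)

module Cut {n : ℕ} (G : SimpleGraph n) where

  cut : (Fin n → Bool) → Fin n → Fin n → Bool
  cut s u w = adj G u w ∧ (s u xor s w)

  uncut : (Fin n → Bool) → Fin n → Fin n → Bool
  uncut s u w = adj G u w ∧ not (s u xor s w)

  flipAt : (Fin n → Bool) → Fin n → Fin n → Bool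
  flipAt s v = updateAt s v not

  cut-symm : ∀ s u w → cut s u w ≡ cut s w u
  cut-symm s u w = cong₂ _∧_ (symm G u w) (xor-comm (s u) (s w))

  uncut-symm : ∀ s u w → uncut s u w ≡ uncut s w u
  uncut-symm s u w = cong₂ _∧_ (symm G u w) (cong not (xor-comm (s u) (s w)))

  cut-irrefl : ∀ s v → cut s v v ≡ false
  cut-irrefl s v rewrite irrefl G v = refl

  uncut-irrefl : ∀ s v → uncut s v v ≡ false
  uncut-irrefl s v rewrite irrefl G v = refl

  cut-crosses : ∀ s u w → T (cut s u w) → s u ≢ s w
  cut-crosses s u w uw∈cut su≡sw =
    subst T (trans (cong (_xor s w) su≡sw) (xor-same (s w))) (proj₂ (Equivalence.to T-∧ uw∈cut))

  cut-isBipartite : ∀ s → IsBipartite (cut s)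
  cut-isBipartite s = s , cut-crosses s

  cut-spanning : ∀ s → SpanningSubgraph G (cut s)
  cut-spanning s = record
    { sub-symm   = cut-symm s
    ; sub-irrefl = cut-irrefl s
    ; sub-edges  = λ u w → proj₁ ∘ Equivalence.to T-∧
    }

  adj⇒cut⊎uncut : ∀ s u w → T (adj G u w) → T (cut s u w) ⊎ T (uncut s u w)
  adj⇒cut⊎uncut s u w uw∈G with adj G u w | s u xor s w
  ... | true | true  = inj₁ _
  ... | true | false = inj₂ _

  deg-cut+deg-uncut : ∀ s v → deg (cut s) v + deg (uncut s) v ≡ deg (adj G) v
  deg-cut+deg-uncut s v = begin
    deg (cut s) v + deg (uncut s) v             ≡⟨ cong₂ _+_ (deg≡∑ (cut s) v) (deg≡∑ (uncut s) v) ⟩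
    sum (𝟙 ∘ cut s v) + sum (𝟙 ∘ uncut s v)     ≡⟨ ∑-distrib-+ (𝟙 ∘ cut s v) (𝟙 ∘ uncut s v) ⟨
    sum (λ w → 𝟙 (cut s v w) + 𝟙 (uncut s v w)) ≡⟨ sum-cong-≗ (𝟙-cut+𝟙-uncut v) ⟩
    sum (𝟙 ∘ adj G v)                           ≡⟨ deg≡∑ (adj G) v ⟨
    deg (adj G) v                               ∎
    where
    open ≡-Reasoning
    𝟙-cut+𝟙-uncut : ∀ u w → 𝟙 (cut s u w) + 𝟙 (uncut s u w) ≡ 𝟙 (adj G u w)
    𝟙-cut+𝟙-uncut u w with adj G u w | s u xor s w
    ... | true  | true  = refl
    ... | true  | false = refl
    ... | false | _     = refl

  cut-flipAt-away : ∀ s v u w → u ≢ v → w ≢ v → cut (flipAt s v) u w ≡ cut s u w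
  cut-flipAt-away s v u w u≢v w≢v =
    cong₂ (λ a b → adj G u w ∧ (a xor b)) (updateAt-minimal u v s u≢v) (updateAt-minimal w v s w≢v)

  cut-flipAt-from : ∀ s v w → cut (flipAt s v) v w ≡ uncut s v w
  cut-flipAt-from s v w with w ≟ᶠ v
  ... | yes refl = trans (cut-irrefl (flipAt s v) v) (sym (uncut-irrefl s v))
  ... | no w≢v = begin
    adj G v w ∧ (flipAt s v v xor flipAt s v w) ≡⟨ cong₂ (λ a b → adj G v w ∧ (a xor b))
                                                         (updateAt-updates v s) (updateAt-minimal w v s w≢v) ⟩
    adj G v w ∧ (not (s v) xor s w)             ≡⟨ cong (adj G v w ∧_) (not-distribˡ-xor (s v) (s w)) ⟨
    uncut s v w                                 ∎
    where open ≡-Reasoning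

  cut-flipAt-to : ∀ s v u → cut (flipAt s v) u v ≡ uncut s u v
  cut-flipAt-to s v u =
    trans (cut-symm (flipAt s v) u v) (trans (cut-flipAt-from s v u) (uncut-symm s v u))

halving-bound : ∀ dH dK c c′ cG → dK + (dK + 2 * c′) ≤ 3 * dH + (dH + 2 * c) → cG ≤ c + c′ →
                cG + (dH + dK) ≤ 2 * c + 3 * dH
halving-bound dH dK c c′ cG flip-loss cG≤ = *-cancelˡ-≤ 2 (begin
  2 * (cG + (dH + dK))                     ≤⟨ *-monoʳ-≤ 2 (+-monoˡ-≤ (dH + dK) cG≤) ⟩
  2 * (c + c′ + (dH + dK))                 ≡⟨ regroup dH dK c c′ ⟩
  2 * c + 2 * dH + (dK + (dK + 2 * c′))    ≤⟨ +-monoʳ-≤ (2 * c + 2 * dH) flip-loss ⟩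
  2 * c + 2 * dH + (3 * dH + (dH + 2 * c)) ≡⟨ collect dH c ⟩
  2 * (2 * c + 3 * dH)                     ∎)
  where
  open ≤-Reasoning
  regroup : ∀ dH dK c c′ → 2 * (c + c′ + (dH + dK)) ≡ 2 * c + 2 * dH + (dK + (dK + 2 * c′))
  regroup = solve-∀
  collect : ∀ dH c → 2 * c + 2 * dH + (3 * dH + (dH + 2 * c)) ≡ 2 * (2 * c + 3 * dH)
  collect = solve-∀

module Potential {n : ℕ} (G : SimpleGraph n) (C : EdgeColoring G) where
  open Cut G

  term : (Fin n → Bool) → Fin n → ℕ
  term s u = deg (cut s) u + 2 * cdeg (col C) (cut s) u

  Φ : (Fin n → Bool) → ℕ
  Φ s = sum (term s)

  Φ≤ : ∀ s → Φ s ≤ sum (λ (_ : Fin n) → n + 2 * n)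
  Φ≤ s = sum-mono-≤ λ u → +-mono-≤ (deg≤n (cut s) u)
    (*-monoʳ-≤ 2 (≤-trans (cdeg≤deg (col C) (cut s) u) (deg≤n (cut s) u)))

  term-flipAt-neighbour : ∀ s v u → u ≢ v →
    term s u + 𝟙 (uncut s u v) ≤ term (flipAt s v) u + 3 * 𝟙 (cut s u v)
  term-flipAt-neighbour s v u u≢v = combine (deg (cut s) u) (deg (cut s′) u)
    (cdeg (col C) (cut s) u) (cdeg (col C) (cut s′) u) (𝟙 (uncut s u v)) (𝟙 (cut s u v))
    (subst (λ b → deg (cut s) u + 𝟙 b ≤ deg (cut s′) u + 𝟙 (cut s u v)) (cut-flipAt-to s v u)
      (deg-≤-except (cut s) (cut s′) u v agree))
    (cdeg-≤-except (col C) (cut s) (cut s′) u v (λ w w≢v → subst T (agree w w≢v)))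
    where
    s′ = flipAt s v
    agree : ∀ w → w ≢ v → cut s u w ≡ cut s′ u w
    agree w w≢v = sym (cut-flipAt-away s v u w u≢v w≢v)
    combine : ∀ d d′ x x′ k h → d + k ≤ d′ + h → x ≤ x′ + h → d + 2 * x + k ≤ d′ + 2 * x′ + 3 * h
    combine d d′ x x′ k h deg≤ cdeg≤ = begin
      d + 2 * x + k          ≡⟨ gather d x k ⟩
      d + k + 2 * x          ≤⟨ +-mono-≤ deg≤ (*-monoʳ-≤ 2 cdeg≤) ⟩
      d′ + h + 2 * (x′ + h)  ≡⟨ spread d′ x′ h ⟩
      d′ + 2 * x′ + 3 * h    ∎
      where
      open ≤-Reasoning
      gather : ∀ d x k → d + 2 * x + k ≡ d + k + 2 * x
      gather = solve-∀
      spread : ∀ d′ x′ h → d′ + h + 2 * (x′ + h) ≡ d′ + 2 * x′ + 3 * h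
      spread = solve-∀

  Φ-flipAt : ∀ s v → Φ s + deg (uncut s) v + term (flipAt s v) v
                   ≤ Φ (flipAt s v) + 3 * deg (cut s) v + term s v
  Φ-flipAt s v = begin
    Φ s + deg (uncut s) v + term s′ v    ≡⟨ cong₂ _+_ sum-before after-at-v ⟨
    sum before + after v                 ≤⟨ sum-≤-except before after v (term-flipAt-neighbour s v) ⟩
    sum after + before v                 ≡⟨ cong₂ _+_ sum-after before-at-v ⟩
    Φ s′ + 3 * deg (cut s) v + term s v  ∎
    where
    open ≤-Reasoning
    s′ = flipAt s v
    before after : Fin n → ℕ
    before u = term s u + 𝟙 (uncut s u v)
    after u = term s′ u + 3 * 𝟙 (cut s u v)
    sum-before : sum before ≡ Φ s + deg (uncut s) v
    sum-before = trans (∑-distrib-+ (term s) _)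
                       (cong (Φ s +_) (sym (deg≡∑-column (uncut s) (uncut-symm s) v)))
    sum-after : sum after ≡ Φ s′ + 3 * deg (cut s) v
    sum-after = begin-equality
      sum after                            ≡⟨ ∑-distrib-+ (term s′) _ ⟩
      Φ s′ + sum (λ u → 3 * 𝟙 (cut s u v)) ≡⟨ cong (Φ s′ +_) (*-distribˡ-sum 3 (λ u → 𝟙 (cut s u v))) ⟨
      Φ s′ + 3 * sum (λ u → 𝟙 (cut s u v)) ≡⟨ cong (λ d → Φ s′ + 3 * d) (deg≡∑-column (cut s) (cut-symm s) v) ⟨
      Φ s′ + 3 * deg (cut s) v             ∎
    after-at-v : after v ≡ term s′ v
    after-at-v = trans (cong (λ b → term s′ v + 3 * 𝟙 b) (cut-irrefl s v)) (+-identityʳ _)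
    before-at-v : before v ≡ term s v
    before-at-v = trans (cong (λ b → term s v + 𝟙 b) (uncut-irrefl s v)) (+-identityʳ _)

  deg-flipAt : ∀ s v → deg (cut (flipAt s v)) v ≡ deg (uncut s) v
  deg-flipAt s v = begin
    deg (cut (flipAt s v)) v          ≡⟨ deg≡∑ (cut (flipAt s v)) v ⟩
    sum (𝟙 ∘ cut (flipAt s v) v)      ≡⟨ sum-cong-≗ (cong 𝟙 ∘ cut-flipAt-from s v) ⟩
    sum (𝟙 ∘ uncut s v)               ≡⟨ deg≡∑ (uncut s) v ⟨
    deg (uncut s) v                   ∎
    where open ≡-Reasoning

  locallyMaximal⇒degree-bound : ∀ s → LocallyMaximal Φ flipAt s → ∀ v →
    2 * cdeg (col C) (cut s) v + 3 * deg (cut s) v ≥ cdeg (col C) (adj G) v + deg (adj G) v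
  locallyMaximal⇒degree-bound s maximal v =
    subst (λ d → cdeg (col C) (adj G) v + d ≤ 2 * cH + 3 * dH) (deg-cut+deg-uncut s v)
      (halving-bound dH dK cH cH′ (cdeg (col C) (adj G) v) flip-loss colours-split)
    where
    s′ = flipAt s v
    dH = deg (cut s) v
    dK = deg (uncut s) v
    cH = cdeg (col C) (cut s) v
    cH′ = cdeg (col C) (cut s′) v
    flip-loss : dK + (dK + 2 * cH′) ≤ 3 * dH + (dH + 2 * cH)
    flip-loss = +-cancelˡ-≤ (Φ s) _ _ (begin
      Φ s + (dK + (dK + 2 * cH′))    ≡⟨ cong (λ d → Φ s + (dK + (d + 2 * cH′))) (deg-flipAt s v) ⟨
      Φ s + (dK + term s′ v)         ≡⟨ +-assoc (Φ s) dK (term s′ v) ⟨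
      Φ s + dK + term s′ v           ≤⟨ Φ-flipAt s v ⟩
      Φ s′ + 3 * dH + term s v       ≤⟨ +-monoˡ-≤ (term s v) (+-monoˡ-≤ (3 * dH) (maximal v)) ⟩
      Φ s + 3 * dH + term s v        ≡⟨ +-assoc (Φ s) (3 * dH) (term s v) ⟩
      Φ s + (3 * dH + (dH + 2 * cH)) ∎)
      where open ≤-Reasoning
    colours-split : cdeg (col C) (adj G) v ≤ cH + cH′
    colours-split = cdeg-≤-+ (col C) (adj G) (cut s) (cut s′) v λ w vw∈G →
      map₂ (subst T (sym (cut-flipAt-from s v w))) (adj⇒cut⊎uncut s v w vw∈G)

lemma7 : (n : ℕ) (G : SimpleGraph n) (C : EdgeColoring G) →
    Σ (Fin n → Fin n → Bool) λ H →
    SpanningSubgraph G H × IsBipartite H ×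
    (∀ v → 2 * cdeg (col C) H v + 3 * deg H v ≥ cdeg (col C) (adj G) v + deg (adj G) v)
lemma7 n G C =
  let s , maximal = locallyMaximal-exists Φ flipAt _ Φ≤ (λ _ → true)
  in cut s , cut-spanning s , cut-isBipartite s , locallyMaximal⇒degree-bound s maximal
  where
  open Cut G
  open Potential G C
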